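{- For any $w,w'\in\mathcal{C}\langle A\rangle$ and $M\ge1$, $Z^{\mathcal{S},\ast}_{q,M}(w\ast_{\hbar}w')=Z^{\mathcal{S},\ast}_{q,M}(w)\,Z^{\mathcal{S},\ast}_{q,M}(w')$.
   Context: Let $\mathcal{C}=\mathbb{Q}[\hbar]$, $\mathfrak{H}=\mathcal{C}\langle a,b\rangle$ (non-commutative). For $k\ge1$, $g_{k}=ba^{k}$, $e_{k}=b(a+\hbar)a^{k-1}$ (so $e_1-g_1=\hbar b$). $A=\{\hbar b\}\cup\{ba^{k}\mid k\ge1\}$, $\mathcal{C}\langle A\rangle$ the $\mathcal{C}$-subalgebra generated by $1$ and $A$, $\mathfrak{z}$ the $\mathcal{C}$-span of $A$. Fix $q\in\mathbb{C}$, $0<|q|<1$; $\mathbb{C}$ is a $\mathcal{C}$-module with $\hbar$ acting by $1-q$; $[m]=(1-q^m)/(1-q)$; $F_{q}(m;\cdot):\mathfrak{z}\to\mathbb{C}$ is the $\mathcal{C}$-linear map with $F_{q}(m;e_{1}-g_{1})=1-q$, $F_q(m;g_k)=q^{km}/[m]^k$; $Z_{q,M}:\mathcal{C}\langle A\rangle\to\mathbb{C}$ is $\mathcal{C}$-linear with $Z_{q,M}(1)=1$, $Z_{q,M}(u_1\cdots u_r)=\sum_{0<m_1<\cdots<m_r<M}\prod_iF_q(m_i;u_i)$ for $u_i\in A$. Harmonic product: $\circ_\hbar:\mathfrak{z}\times\mathfrak{z}\to\mathfrak{z}$ symmetric $\mathcal{C}$-bilinear with $(e_1-g_1)\circ_\hbar(e_1-g_1)=\hbar(e_1-g_1)$,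 $(e_1-g_1)\circ_\hbar g_k=\hbar g_k$, $g_k\circ_\hbar g_l=g_{k+l}$; $\ast_\hbar$ is the $\mathcal{C}$-bilinear product on $\mathcal{C}\langle A\rangle$ with $w\ast_\hbar1=1\ast_\hbar w=w$, $(wu)\ast_\hbar(w'v)=(w\ast_\hbar w'v)u+(wu\ast_\hbar w')v+(w\ast_\hbar w')(u\circ_\hbar v)$ for $u,v\in A$. Let $\psi^{\ast}$ be the $\mathcal{C}$-algebra anti-automorphism of $\mathcal{C}\langle A\rangle$ with $\psi^\ast(\hbar b)=\hbar b$ and $\psi^\ast(ba^k)=b(-a)^k$ for $k\ge1$. Let $w^{\mathcal{S},\ast}_\hbar:\mathcal{C}\langle A\rangle\to\mathcal{C}\langle A\rangle$ be $\mathcal{C}$-linear with $w^{\mathcal{S},\ast}_\hbar(1)=1$ and $w^{\mathcal{S},\ast}_\hbar(u_1\cdots u_r)=\sum_{i=0}^r (u_1\cdots u_i)\ast_\hbar\psi^\ast(u_{i+1}\cdots u_r)$ for $u_j\in A$, and $Z^{\mathcal{S},\ast}_{q,M}=Z_{q,M}\circ w^{\mathcal{S},\ast}_\hbar$. -}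

module Defs where

open import Level using (Level)
open import Data.Nat as ℕ using (ℕ; zero; suc)
open import Data.Rational as ℚ using (ℚ)
open import Data.List using (List; []; _∷_; _++_; map; concatMap)
open import Data.Product using (_×_; _,_; proj₁; proj₂)
open import Algebra.Bundles using (CommutativeRing)

-- The alphabet A is encoded by ℕ:
--   letter 0      ↔  ħb  (= e₁ - g₁)
--   letter k ≥ 1  ↔  b aᵏ (= g_k)
-- Words over A are snoc-lists (last letter outermost), so that the
-- recursive definition of the harmonic product (which peels off the
-- LAST letters) is structural.

data Word : Set where
  ε   : Word
  _▷_ : Word → ℕ → Word

infixl 5 _▷_

_◁_ : ℕ → Word → Word
u ◁ ε       = ε ▷ u
u ◁ (w ▷ v) = (u ◁ w) ▷ v

-- The words over A form a 𝒞-basis of 𝒞⟨A⟩ (distinct words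
-- in A give distinct words in a,b), so an element of 𝒞⟨A⟩ is a finite
-- 𝒞-linear combination of words; a 𝒞-coefficient is in turn a finite
-- sum of monomials c ħⁿ.  We represent an element of 𝒞⟨A⟩ by a list of
-- terms  (c , n , w)  standing for  c ħⁿ w ; the element is their sum.

Term : Set
Term = ℚ × ℕ × Word

Elem : Set
Elem = List Term

word : Word → Elem
word w = (ℚ.1ℚ , 0 , w) ∷ []

scale : ℚ → ℕ → Elem → Elem
scale c n = map (λ { (d , m , w) → (c ℚ.* d , n ℕ.+ m , w) })

appendL : Elem → ℕ → Elem
appendL x u = map (λ { (d , m , w) → (d , m , w ▷ u) }) x

-- harmonic product on letters:  u ∘ħ v  as a term  ħ^e · (letter)
--   0 ∘ 0 = ħ·0,  0 ∘ k = k ∘ 0 = ħ·k,  k ∘ l = (k+l)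
circ : ℕ → ℕ → ℕ × ℕ
circ zero    v       = 1 , v
circ (suc k) zero    = 1 , suc k
circ (suc k) (suc l) = 0 , suc k ℕ.+ suc l

_⊛_ : Word → Word → Elem
ε ⊛ w'              = word w'
(w ▷ u) ⊛ ε         = word (w ▷ u)
(w ▷ u) ⊛ (w' ▷ v)  =
  appendL (w ⊛ (w' ▷ v)) u ++ appendL ((w ▷ u) ⊛ w') v
    ++ scale ℚ.1ℚ (proj₁ (circ u v)) (appendL (w ⊛ w') (proj₂ (circ u v)))

_∗ħ_ : Elem → Elem → Elem
x ∗ħ y = concatMap (λ { (c , n , w) →
           concatMap (λ { (c' , n' , w') → scale (c ℚ.* c') (n ℕ.+ n') (w ⊛ w') }) y }) x

-- ψ* : anti-automorphism, ψ*(ħb) = ħb, ψ*(baᵏ) = (-1)ᵏ baᵏ.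

sign : ℕ → ℚ
sign zero    = ℚ.1ℚ
sign (suc k) = ℚ.- (sign k)

psiW : Word → ℚ × Word
psiW ε       = ℚ.1ℚ , ε
psiW (w ▷ u) with psiW w
... | (c , r) = sign u ℚ.* c , u ◁ r

splits : Word → List (Word × Word)
splits ε       = (ε , ε) ∷ []
splits (w ▷ u) = map (λ { (p , s) → (p , s ▷ u) }) (splits w) ++ ((w ▷ u , ε) ∷ [])

wSW : Word → Elem
wSW w = concatMap (λ { (p , s) → psiTerm p (psiW s) }) (splits w)
  where
  psiTerm : Word → ℚ × Word → Elem
  psiTerm p (c , r) = scale c 0 (p ⊛ r)

wS : Elem → Elem
wS = concatMap (λ { (c , n , w) → scale c n (wSW w) })

-- Evaluation in a commutative ring K (standing in for ℂ) equipped with a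
-- ring homomorphism ι : ℚ → K, a parameter q, and inverses inv m of
-- [m] = 1 + q + ⋯ + q^{m-1}.  ħ acts on K as 1 - q.

module Eval {c ℓ : Level} (K : CommutativeRing c ℓ)
            (ι : ℚ → CommutativeRing.Carrier K)
            (q : CommutativeRing.Carrier K)
            (inv : ℕ → CommutativeRing.Carrier K) where
  open CommutativeRing K

  pow : Carrier → ℕ → Carrier
  pow x zero    = 1#
  pow x (suc n) = x * pow x n

  qint : ℕ → Carrier
  qint zero    = 0#
  qint (suc m) = pow q m + qint m

  ħ : Carrier
  ħ = 1# - q

  F : ℕ → ℕ → Carrier
  F m zero    = ħ
  F m (suc k) = pow q (suc k ℕ.* m) * pow (inv m) (suc k)

  sumTo : ℕ → (ℕ → Carrier) → Carrier
  sumTo zero          f = 0#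
  sumTo (suc zero)    f = 0#
  sumTo (suc (suc M)) f = sumTo (suc M) f + f (suc M)

  ZW : ℕ → Word → Carrier
  ZW M ε       = 1#
  ZW M (w ▷ u) = sumTo M (λ m → ZW m w * F m u)

  Z : ℕ → Elem → Carrier
  Z M []                  = 0#
  Z M ((c , n , w) ∷ x) = ι c * pow ħ n * ZW M w + Z M x

  ZS : ℕ → Elem → Carrier
  ZS M x = Z M (wS x)

-- Let 𝑍 be the nested sum Σ_{0<m₁<⋯<m_r<M} Π F(mᵢ; uᵢ) on words.  Because ħ^e F(m; u ∘ħ v) = F(m; u) F(m; v),
-- 𝑍 is a character of the harmonic product (the stuffle argument, by induction on the last letters).
-- ψ* reverses a word and twists each letter b aᵏ by (−1)ᵏ; on nested sums this is the reflection m ↦ M − m of the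
-- summation indices, so 𝑍(p ∗ħ ψ*(s)) = 𝑍(p) 𝑍̃(s), where 𝑍̃ is the nested sum for the reflected, sign-twisted
-- weights, which satisfy the same harmonic relation.  Thus Z^{S,∗} is the convolution 𝑍 ⋆ 𝑍̃ along deconcatenation Δ,
-- and since Δ(w ∗ħ w') = Δw ∗ħ Δw', the convolution of two characters is again a character.
module Submission where

open import Defs
open import Level using (Level)
open import Data.Nat as ℕ using (ℕ; zero; suc; _≤_; _<_; _∸_)
import Data.Nat.Properties as ℕₚ
open import Data.Rational as ℚ using (ℚ)
open import Data.Rational.Properties using (+-*-commutativeRing)
open import Data.List using (List; []; _∷_; _++_; map; concatMap)
open import Data.Product using (_,_; proj₁; proj₂)
open import Function using (_∘_)
open import Algebra.Bundles using (CommutativeSemiring; CommutativeRing)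
open import Algebra.Morphism.Structures using (module RingMorphisms)
open import Relation.Binary.PropositionalEquality as ≡ using (_≡_)

m+[n∸m∸o]≡n∸o : ∀ {m n o} → m ≤ n → o ≤ n ∸ m → m ℕ.+ (n ∸ m ∸ o) ≡ n ∸ o
m+[n∸m∸o]≡n∸o {m} {n} {o} m≤n o≤n∸m =
  ≡.trans (≡.sym (ℕₚ.+-∸-assoc m o≤n∸m)) (≡.cong (_∸ o) (ℕₚ.m+[n∸m]≡n m≤n))

n∸suc[n∸suc[m]]≡m : ∀ {m n} → m < n → n ∸ suc (n ∸ suc m) ≡ m
n∸suc[n∸suc[m]]≡m {m} {n} m<n =
  ≡.trans (≡.cong (n ∸_) (≡.sym (ℕₚ.+-∸-assoc 1 m<n))) (ℕₚ.m∸[m∸n]≡n (ℕₚ.<⇒≤ m<n))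

module FiniteSums {c ℓ} (R : CommutativeSemiring c ℓ) where
  open CommutativeSemiring R hiding (zero)
  open import Algebra.Properties.CommutativeSemigroup +-commutativeSemigroup using (interchange)
  open import Relation.Binary.Reasoning.Setoid setoid

  ∑ : {A : Set} → (A → Carrier) → List A → Carrier
  ∑ f []       = 0#
  ∑ f (x ∷ xs) = f x + ∑ f xs

  ∑< : ℕ → (ℕ → Carrier) → Carrier
  ∑< zero    f = 0#
  ∑< (suc n) f = ∑< n f + f n

  syntax ∑< n (λ i → e) = ∑[ i < n ] e

  module _ {A : Set} where

    ∑-cong : {f g : A → Carrier} → (∀ x → f x ≈ g x) → ∀ xs → ∑ f xs ≈ ∑ g xs
    ∑-cong f≈g []       = refl
    ∑-cong f≈g (x ∷ xs) = +-cong (f≈g x) (∑-cong f≈g xs)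

    ∑-++ : ∀ (f : A → Carrier) xs ys → ∑ f (xs ++ ys) ≈ ∑ f xs + ∑ f ys
    ∑-++ f []       ys = sym (+-identityˡ _)
    ∑-++ f (x ∷ xs) ys = trans (+-congˡ (∑-++ f xs ys)) (sym (+-assoc _ _ _))

    ∑-distrib-+ : ∀ (f g : A → Carrier) xs → ∑ (λ x → f x + g x) xs ≈ ∑ f xs + ∑ g xs
    ∑-distrib-+ f g []       = sym (+-identityˡ _)
    ∑-distrib-+ f g (x ∷ xs) = trans (+-congˡ (∑-distrib-+ f g xs)) (interchange _ _ _ _)

    *-distribˡ-∑ : ∀ a (f : A → Carrier) xs → a * ∑ f xs ≈ ∑ (λ x → a * f x) xs
    *-distribˡ-∑ a f []       = zeroʳ a
    *-distribˡ-∑ a f (x ∷ xs) = trans (distribˡ _ _ _) (+-congˡ (*-distribˡ-∑ a f xs))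

    *-distribʳ-∑ : ∀ a (f : A → Carrier) xs → ∑ f xs * a ≈ ∑ (λ x → f x * a) xs
    *-distribʳ-∑ a f []       = zeroˡ a
    *-distribʳ-∑ a f (x ∷ xs) = trans (distribʳ _ _ _) (+-congˡ (*-distribʳ-∑ a f xs))

    ∑-∑<-comm : ∀ N (h : A → ℕ → Carrier) xs → ∑ (λ x → ∑< N (h x)) xs ≈ ∑< N (λ i → ∑ (λ x → h x i) xs)
    ∑-∑<-comm zero    h []       = refl
    ∑-∑<-comm zero    h (x ∷ xs) = trans (+-congˡ (∑-∑<-comm zero h xs)) (+-identityˡ _)
    ∑-∑<-comm (suc N) h xs       = begin
      ∑ (λ x → ∑< N (h x) + h x N) xs                        ≈⟨ ∑-distrib-+ (λ x → ∑< N (h x)) (λ x → h x N) xs ⟩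
      ∑ (λ x → ∑< N (h x)) xs + ∑ (λ x → h x N) xs          ≈⟨ +-congʳ (∑-∑<-comm N h xs) ⟩
      ∑< N (λ i → ∑ (λ x → h x i) xs) + ∑ (λ x → h x N) xs  ∎

  ∑-linear₃ : ∀ {A : Set} k (f g h : A → Carrier) xs →
              ∑ (λ x → f x + (g x + k * h x)) xs ≈ ∑ f xs + (∑ g xs + k * ∑ h xs)
  ∑-linear₃ k f g h xs = begin
    ∑ (λ x → f x + (g x + k * h x)) xs             ≈⟨ ∑-distrib-+ f _ xs ⟩
    ∑ f xs + ∑ (λ x → g x + k * h x) xs           ≈⟨ +-congˡ (∑-distrib-+ g _ xs) ⟩
    ∑ f xs + (∑ g xs + ∑ (λ x → k * h x) xs)      ≈⟨ +-congˡ (+-congˡ (*-distribˡ-∑ k h xs)) ⟨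
    ∑ f xs + (∑ g xs + k * ∑ h xs)                ∎

  ∑-map : ∀ {A B : Set} (f : B → Carrier) (g : A → B) xs → ∑ f (map g xs) ≡ ∑ (f ∘ g) xs
  ∑-map f g []       = ≡.refl
  ∑-map f g (x ∷ xs) = ≡.cong (f (g x) +_) (∑-map f g xs)

  ∑-concatMap : ∀ {A B : Set} (f : B → Carrier) (g : A → List B) xs →
                ∑ f (concatMap g xs) ≈ ∑ (λ x → ∑ f (g x)) xs
  ∑-concatMap f g []       = refl
  ∑-concatMap f g (x ∷ xs) = trans (∑-++ f (g x) (concatMap g xs)) (+-congˡ (∑-concatMap f g xs))

  ∑<-cong-< : ∀ N {f g : ℕ → Carrier} → (∀ i → i < N → f i ≈ g i) → ∑< N f ≈ ∑< N g
  ∑<-cong-< zero    f≈g = refl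
  ∑<-cong-< (suc N) f≈g = +-cong (∑<-cong-< N (λ i i<N → f≈g i (ℕₚ.m<n⇒m<1+n i<N))) (f≈g N ℕₚ.≤-refl)

  ∑<-cong : ∀ N {f g : ℕ → Carrier} → (∀ i → f i ≈ g i) → ∑< N f ≈ ∑< N g
  ∑<-cong N f≈g = ∑<-cong-< N (λ i _ → f≈g i)

  ∑<-distrib-+ : ∀ N (f g : ℕ → Carrier) → ∑[ i < N ] (f i + g i) ≈ ∑< N f + ∑< N g
  ∑<-distrib-+ zero    f g = sym (+-identityˡ _)
  ∑<-distrib-+ (suc N) f g = trans (+-congʳ (∑<-distrib-+ N f g)) (interchange _ _ _ _)

  *-distribˡ-∑< : ∀ N a (f : ℕ → Carrier) → a * ∑< N f ≈ ∑[ i < N ] (a * f i)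
  *-distribˡ-∑< zero    a f = zeroʳ a
  *-distribˡ-∑< (suc N) a f = trans (distribˡ _ _ _) (+-congʳ (*-distribˡ-∑< N a f))

  *-distribʳ-∑< : ∀ N a (f : ℕ → Carrier) → ∑< N f * a ≈ ∑[ i < N ] (f i * a)
  *-distribʳ-∑< zero    a f = zeroˡ a
  *-distribʳ-∑< (suc N) a f = trans (distribʳ _ _ _) (+-congʳ (*-distribʳ-∑< N a f))

  ∑<-suc : ∀ N (f : ℕ → Carrier) → ∑< (suc N) f ≈ f 0 + ∑[ i < N ] f (suc i)
  ∑<-suc zero    f = +-comm _ _
  ∑<-suc (suc N) f = trans (+-congʳ (∑<-suc N f)) (+-assoc _ _ _)

  ∑<-reverse : ∀ N (f : ℕ → Carrier) → ∑< N f ≈ ∑[ j < N ] f (N ∸ suc j)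
  ∑<-reverse zero    f = refl
  ∑<-reverse (suc N) f = begin
    ∑< N f + f N                          ≈⟨ +-comm _ _ ⟩
    f N + ∑< N f                          ≈⟨ +-congˡ (∑<-reverse N f) ⟩
    f N + ∑[ j < N ] f (N ∸ suc j)        ≈⟨ ∑<-suc N (λ j → f (N ∸ j)) ⟨
    ∑[ j < suc N ] f (N ∸ j)              ∎

  ∑<-triangle : ∀ N (h : ℕ → ℕ → Carrier) →
                ∑[ n < N ] ∑[ i < n ] h i n ≈ ∑[ i < N ] ∑[ j < N ∸ suc i ] h i (suc i ℕ.+ j)
  ∑<-triangle zero    h = refl
  ∑<-triangle (suc N) h = begin
    ∑[ n < N ] ∑[ i < n ] h i n + ∑[ i < N ] h i N
      ≈⟨ +-congʳ (∑<-triangle N h) ⟩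
    ∑[ i < N ] ∑[ j < N ∸ suc i ] h i (suc i ℕ.+ j) + ∑[ i < N ] h i N
      ≈⟨ ∑<-distrib-+ N _ _ ⟨
    ∑[ i < N ] (∑[ j < N ∸ suc i ] h i (suc i ℕ.+ j) + h i N)
      ≈⟨ ∑<-cong-< N extend ⟩
    ∑[ i < N ] ∑[ j < N ∸ i ] h i (suc i ℕ.+ j)
      ≈⟨ +-identityʳ _ ⟨
    ∑[ i < N ] ∑[ j < N ∸ i ] h i (suc i ℕ.+ j) + 0#
      ≈⟨ +-congˡ (reflexive (≡.cong (λ k → ∑[ j < k ] h N (suc N ℕ.+ j)) (ℕₚ.n∸n≡0 N))) ⟨
    ∑[ i < suc N ] ∑[ j < N ∸ i ] h i (suc i ℕ.+ j)  ∎
    where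
    extend : ∀ i → i < N → ∑[ j < N ∸ suc i ] h i (suc i ℕ.+ j) + h i N ≈ ∑[ j < N ∸ i ] h i (suc i ℕ.+ j)
    extend i i<N rewrite ℕₚ.+-∸-assoc 1 i<N | ℕₚ.m+[n∸m]≡n i<N = refl

module HarmonicAlgebra {c ℓ} (K : CommutativeRing c ℓ)
    (ι : ℚ → CommutativeRing.Carrier K)
    (ι-hom : RingMorphisms.IsRingHomomorphism (CommutativeRing.rawRing +-*-commutativeRing) (CommutativeRing.rawRing K) ι)
    (q : CommutativeRing.Carrier K) (inv : ℕ → CommutativeRing.Carrier K) where
  open CommutativeRing K hiding (zero)
  open Eval K ι q inv
  open FiniteSums commutativeSemiring
  open RingMorphisms.IsRingHomomorphism ι-hom using (*-homo; 1#-homo; -‿homo)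
  open import Algebra.Properties.Ring ring using (-‿distribˡ-*)
  open import Algebra.Properties.CommutativeSemigroup *-commutativeSemigroup
    using (x∙yz≈y∙xz) renaming (interchange to *-interchange)
  open import Algebra.Solver.Ring.NaturalCoefficients.Default commutativeSemiring using (solve; _:=_; _:+_; _:*_)
  open import Relation.Binary.Reasoning.Setoid setoid

  pow-+ : ∀ x m n → pow x (m ℕ.+ n) ≈ pow x m * pow x n
  pow-+ x zero    n = sym (*-identityˡ _)
  pow-+ x (suc m) n = trans (*-congˡ (pow-+ x m n)) (sym (*-assoc _ _ _))

  ∘-power ∘-letter : ℕ → ℕ → ℕ
  ∘-power  u v = proj₁ (circ u v)
  ∘-letter u v = proj₂ (circ u v)

  ⟦_⟧ : (Word → Carrier) → Elem → Carrier
  ⟦ f ⟧ = ∑ (λ { (c , n , w) → ι c * pow ħ n * f w })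

  ⟦⟧-cong : ∀ {f g : Word → Carrier} → (∀ w → f w ≈ g w) → ∀ X → ⟦ f ⟧ X ≈ ⟦ g ⟧ X
  ⟦⟧-cong f≈g = ∑-cong (λ { (c , n , w) → *-congˡ (f≈g w) })

  ⟦⟧-++ : ∀ f X Y → ⟦ f ⟧ (X ++ Y) ≈ ⟦ f ⟧ X + ⟦ f ⟧ Y
  ⟦⟧-++ f = ∑-++ _

  ⟦⟧-distrib-+ : ∀ f g X → ⟦ (λ w → f w + g w) ⟧ X ≈ ⟦ f ⟧ X + ⟦ g ⟧ X
  ⟦⟧-distrib-+ f g X = trans (∑-cong (λ _ → distribˡ _ _ _) X) (∑-distrib-+ _ _ X)

  ⟦⟧-*ˡ : ∀ a f X → ⟦ (λ w → a * f w) ⟧ X ≈ a * ⟦ f ⟧ X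
  ⟦⟧-*ˡ a f X = trans (∑-cong (λ _ → x∙yz≈y∙xz _ _ _) X) (sym (*-distribˡ-∑ a _ X))

  ⟦⟧-*ʳ : ∀ a f X → ⟦ (λ w → f w * a) ⟧ X ≈ ⟦ f ⟧ X * a
  ⟦⟧-*ʳ a f X = trans (∑-cong (λ _ → sym (*-assoc _ _ _)) X) (sym (*-distribʳ-∑ a _ X))

  ⟦⟧-zero : ∀ X → ⟦ (λ _ → 0#) ⟧ X ≈ 0#
  ⟦⟧-zero []      = refl
  ⟦⟧-zero (_ ∷ X) = trans (+-cong (zeroʳ _) (⟦⟧-zero X)) (+-identityʳ _)

  ⟦⟧-∑< : ∀ N (h : ℕ → Word → Carrier) X → ⟦ (λ w → ∑[ i < N ] h i w) ⟧ X ≈ ∑[ i < N ] ⟦ h i ⟧ X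
  ⟦⟧-∑< N h X = trans (∑-cong (λ _ → *-distribˡ-∑< N _ _) X) (∑-∑<-comm N _ X)

  ⟦⟧-scale : ∀ f c n X → ⟦ f ⟧ (scale c n X) ≈ ι c * pow ħ n * ⟦ f ⟧ X
  ⟦⟧-scale f c n X = begin
    ⟦ f ⟧ (scale c n X)                            ≡⟨ ∑-map _ _ X ⟩
    ∑ (λ { (d , m , w) → ι (c ℚ.* d) * pow ħ (n ℕ.+ m) * f w }) X
      ≈⟨ ∑-cong (λ { (d , m , w) → merge (ι c) (ι d) (pow ħ n) (pow ħ m) (f w) (*-homo c d) (pow-+ ħ n m) }) X ⟩
    ∑ (λ { (d , m , w) → ι c * pow ħ n * (ι d * pow ħ m * f w) }) X
      ≈⟨ *-distribˡ-∑ _ _ X ⟨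
    ι c * pow ħ n * ⟦ f ⟧ X                        ∎
    where
    merge : ∀ {cd nm} a b x y z → cd ≈ a * b → nm ≈ x * y → cd * nm * z ≈ a * x * (b * y * z)
    merge a b x y z cd≈ nm≈ = trans (*-congʳ (*-cong cd≈ nm≈))
      (solve 5 (λ a b x y z → a :* b :* (x :* y) :* z := a :* x :* (b :* y :* z)) refl a b x y z)

  ⟦⟧-appendL : ∀ f X u → ⟦ f ⟧ (appendL X u) ≈ ⟦ f ∘ (_▷ u) ⟧ X
  ⟦⟧-appendL f X u = reflexive (∑-map _ _ X)

  ⟦⟧-word : ∀ f w → ⟦ f ⟧ (word w) ≈ f w
  ⟦⟧-word f w = trans (+-identityʳ _) (trans (*-congʳ (trans (*-identityʳ _) 1#-homo)) (*-identityˡ _))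

  ⟦⟧-⊛ε : ∀ f w → ⟦ f ⟧ (w ⊛ ε) ≈ f w
  ⟦⟧-⊛ε f ε       = ⟦⟧-word f ε
  ⟦⟧-⊛ε f (w ▷ u) = ⟦⟧-word f (w ▷ u)

  ⟦⟧-⊛-▷▷ : ∀ f w u w' v →
    ⟦ f ⟧ ((w ▷ u) ⊛ (w' ▷ v)) ≈
      ⟦ f ∘ (_▷ u) ⟧ (w ⊛ (w' ▷ v)) + (⟦ f ∘ (_▷ v) ⟧ ((w ▷ u) ⊛ w')
        + pow ħ (∘-power u v) * ⟦ f ∘ (_▷ ∘-letter u v) ⟧ (w ⊛ w'))
  ⟦⟧-⊛-▷▷ f w u w' v = begin
    ⟦ f ⟧ (appendL X₁ u ++ appendL X₂ v ++ scale ℚ.1ℚ e (appendL X₃ c′))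
      ≈⟨ trans (⟦⟧-++ f (appendL X₁ u) _) (+-congˡ (⟦⟧-++ f (appendL X₂ v) _)) ⟩
    ⟦ f ⟧ (appendL X₁ u) + (⟦ f ⟧ (appendL X₂ v) + ⟦ f ⟧ (scale ℚ.1ℚ e (appendL X₃ c′)))
      ≈⟨ +-cong (⟦⟧-appendL f X₁ u) (+-cong (⟦⟧-appendL f X₂ v)
           (trans (⟦⟧-scale f ℚ.1ℚ e (appendL X₃ c′)) (*-cong (trans (*-congʳ 1#-homo) (*-identityˡ _)) (⟦⟧-appendL f X₃ c′)))) ⟩
    ⟦ f ∘ (_▷ u) ⟧ X₁ + (⟦ f ∘ (_▷ v) ⟧ X₂ + pow ħ e * ⟦ f ∘ (_▷ c′) ⟧ X₃)  ∎
    where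
    X₁ = w ⊛ (w' ▷ v)
    X₂ = (w ▷ u) ⊛ w'
    X₃ = w ⊛ w'
    e  = ∘-power u v
    c′ = ∘-letter u v

  ⟦⟧-concatMap : ∀ f (g : Term → Elem) X → ⟦ f ⟧ (concatMap g X) ≈ ∑ (λ t → ⟦ f ⟧ (g t)) X
  ⟦⟧-concatMap f = ∑-concatMap _

  IsCharacter : (Word → Carrier) → Set ℓ
  IsCharacter f = ∀ w w' → ⟦ f ⟧ (w ⊛ w') ≈ f w * f w'

  ⟦⟧-∗ħ : ∀ {f} → IsCharacter f → ∀ X X' → ⟦ f ⟧ (X ∗ħ X') ≈ ⟦ f ⟧ X * ⟦ f ⟧ X'
  ⟦⟧-∗ħ {f} f-char X X' =
    trans (⟦⟧-concatMap f _ X)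
      (trans (∑-cong (λ { (c , n , w) →
                 trans (⟦⟧-concatMap f _ X')
                   (trans (∑-cong (λ { (c' , n' , w') → termwise c n w c' n' w' }) X')
                          (sym (*-distribˡ-∑ _ _ X'))) }) X)
             (sym (*-distribʳ-∑ _ _ X)))
    where
    termwise : ∀ c n w c' n' w' → ⟦ f ⟧ (scale (c ℚ.* c') (n ℕ.+ n') (w ⊛ w'))
                                    ≈ ι c * pow ħ n * f w * (ι c' * pow ħ n' * f w')
    termwise c n w c' n' w' =
      trans (⟦⟧-scale f _ _ (w ⊛ w'))
        (trans (*-cong (*-cong (*-homo c c') (pow-+ ħ n n')) (f-char w w'))
          (solve 6 (λ a b x y s t → a :* b :* (x :* y) :* (s :* t) := a :* x :* s :* (b :* y :* t))
                 refl (ι c) (ι c') (pow ħ n) (pow ħ n') (f w) (f w')))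

  Weights : Set c
  Weights = ℕ → ℕ → Carrier

  nestedSum : Weights → ℕ → Word → Carrier
  nestedSum G N ε       = 1#
  nestedSum G N (w ▷ u) = ∑[ i < N ] (nestedSum G i w * G i u)

  IsHarmonic : Weights → Set ℓ
  IsHarmonic G = ∀ i u v → pow ħ (∘-power u v) * G i (∘-letter u v) ≈ G i u * G i v

  ⟦nestedSum-suc∘▷⟧ : ∀ G n u X →
    ⟦ nestedSum G (suc n) ∘ (_▷ u) ⟧ X ≈ ⟦ nestedSum G n ∘ (_▷ u) ⟧ X + ⟦ nestedSum G n ⟧ X * G n u
  ⟦nestedSum-suc∘▷⟧ G n u X = trans (⟦⟧-distrib-+ _ _ X) (+-congˡ (⟦⟧-*ʳ (G n u) (nestedSum G n) X))

  nestedSum-isCharacter : ∀ {G} → IsHarmonic G → ∀ N → IsCharacter (nestedSum G N)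
  nestedSum-isCharacter {G} harm N ε       w' = trans (⟦⟧-word (nestedSum G N) w') (sym (*-identityˡ _))
  nestedSum-isCharacter {G} harm N (w ▷ u) ε  = trans (⟦⟧-word (nestedSum G N) (w ▷ u)) (sym (*-identityʳ _))
  nestedSum-isCharacter {G} harm zero (w ▷ u) (w' ▷ v) =
    trans (⟦⟧-⊛-▷▷ (nestedSum G 0) w u w' v)
      (trans (+-cong (⟦⟧-zero (w ⊛ (w' ▷ v))) (+-cong (⟦⟧-zero ((w ▷ u) ⊛ w')) (*-congˡ (⟦⟧-zero (w ⊛ w')))))
        (trans (+-identityˡ _) (trans (+-identityˡ _) (trans (zeroʳ _) (sym (zeroˡ _))))))
  nestedSum-isCharacter {G} harm (suc n) (w ▷ u) (w' ▷ v) = begin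
    ⟦ Y₊ ⟧ ((w ▷ u) ⊛ (w' ▷ v))
      ≈⟨ ⟦⟧-⊛-▷▷ Y₊ w u w' v ⟩
    ⟦ Y₊ ∘ (_▷ u) ⟧ X₁ + (⟦ Y₊ ∘ (_▷ v) ⟧ X₂ + p * ⟦ Y₊ ∘ (_▷ c′) ⟧ X₃)
      ≈⟨ +-cong (⟦nestedSum-suc∘▷⟧ G n u X₁)
           (+-cong (⟦nestedSum-suc∘▷⟧ G n v X₂) (*-congˡ (⟦nestedSum-suc∘▷⟧ G n c′ X₃))) ⟩
    (⟦ Y ∘ (_▷ u) ⟧ X₁ + ⟦ Y ⟧ X₁ * G n u)
      + ((⟦ Y ∘ (_▷ v) ⟧ X₂ + ⟦ Y ⟧ X₂ * G n v) + p * (⟦ Y ∘ (_▷ c′) ⟧ X₃ + ⟦ Y ⟧ X₃ * G n c′))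
      ≈⟨ solve 10 (λ a₁ a₂ a₃ x₁ x₂ x₃ gu gv gc p →
             (a₁ :+ x₁ :* gu) :+ ((a₂ :+ x₂ :* gv) :+ p :* (a₃ :+ x₃ :* gc))
          := (a₁ :+ (a₂ :+ p :* a₃)) :+ (x₁ :* gu :+ (x₂ :* gv :+ p :* gc :* x₃)))
          refl _ _ _ _ _ _ _ _ _ _ ⟩
    (⟦ Y ∘ (_▷ u) ⟧ X₁ + (⟦ Y ∘ (_▷ v) ⟧ X₂ + p * ⟦ Y ∘ (_▷ c′) ⟧ X₃))
      + (⟦ Y ⟧ X₁ * G n u + (⟦ Y ⟧ X₂ * G n v + p * G n c′ * ⟦ Y ⟧ X₃))
      ≈⟨ +-cong (trans (sym (⟦⟧-⊛-▷▷ Y w u w' v)) (IH (w ▷ u) (w' ▷ v)))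
           (+-cong (*-congʳ (IH w (w' ▷ v))) (+-cong (*-congʳ (IH (w ▷ u) w')) (*-cong (harm n u v) (IH w w')))) ⟩
    A * B + (a * B * G n u + (A * b * G n v + G n u * G n v * (a * b)))
      ≈⟨ solve 6 (λ A B a b x y → A :* B :+ (a :* B :* x :+ (A :* b :* y :+ x :* y :* (a :* b)))
                                  := (A :+ a :* x) :* (B :+ b :* y)) refl A B a b (G n u) (G n v) ⟩
    (A + a * G n u) * (B + b * G n v)  ∎
    where
    Y₊ = nestedSum G (suc n)
    Y  = nestedSum G n
    IH = nestedSum-isCharacter harm n
    X₁ = w ⊛ (w' ▷ v)
    X₂ = (w ▷ u) ⊛ w'
    X₃ = w ⊛ w'
    p  = pow ħ (∘-power u v)
    c′ = ∘-letter u v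
    A  = Y (w ▷ u)
    B  = Y (w' ▷ v)
    a  = Y w
    b  = Y w'

  shift : ℕ → Weights → Weights
  shift k G j = G (k ℕ.+ j)

  nestedSum-cong-< : ∀ {G H} N w → (∀ i → i < N → ∀ u → G i u ≈ H i u) → nestedSum G N w ≈ nestedSum H N w
  nestedSum-cong-< N ε       G≈H = refl
  nestedSum-cong-< N (w ▷ u) G≈H = ∑<-cong-< N (λ i i<N →
    *-cong (nestedSum-cong-< i w (λ i' i'<i → G≈H i' (ℕₚ.<-trans i'<i i<N))) (G≈H i i<N u))

  nestedSum-◁ : ∀ G N u r →
    nestedSum G N (u ◁ r) ≈ ∑[ i < N ] (G i u * nestedSum (shift (suc i) G) (N ∸ suc i) r)
  nestedSum-◁ G N u ε       = ∑<-cong N (λ i → trans (*-identityˡ _) (sym (*-identityʳ _)))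
  nestedSum-◁ G N u (r ▷ v) = begin
    ∑[ n < N ] (nestedSum G n (u ◁ r) * G n v)
      ≈⟨ ∑<-cong N (λ n → trans (*-congʳ (nestedSum-◁ G n u r)) (*-distribʳ-∑< n (G n v) _)) ⟩
    ∑[ n < N ] ∑[ i < n ] (G i u * Y i (n ∸ suc i) * G n v)
      ≈⟨ ∑<-triangle N (λ i n → G i u * Y i (n ∸ suc i) * G n v) ⟩
    ∑[ i < N ] ∑[ j < N ∸ suc i ] (G i u * Y i (suc i ℕ.+ j ∸ suc i) * G (suc i ℕ.+ j) v)
      ≈⟨ ∑<-cong N (λ i → trans (∑<-cong (N ∸ suc i) (λ j → trans (*-assoc _ _ _)
           (*-congˡ (*-congʳ (reflexive (≡.cong (Y i) (ℕₚ.m+n∸m≡n (suc i) j)))))))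
           (sym (*-distribˡ-∑< (N ∸ suc i) (G i u) _))) ⟩
    ∑[ i < N ] (G i u * ∑[ j < N ∸ suc i ] (Y i j * G (suc i ℕ.+ j) v))  ∎
    where
    Y : ℕ → ℕ → Carrier
    Y i k = nestedSum (shift (suc i) G) k r

  sgn : ℕ → Carrier
  sgn u = ι (sign u)

  mirror : ℕ → Weights → Weights
  mirror N G j u = sgn u * G (N ∸ suc j) u

  nestedSum-ψ : ∀ s G N → ι (proj₁ (psiW s)) * nestedSum G N (proj₂ (psiW s)) ≈ nestedSum (mirror N G) N s
  nestedSum-ψ ε       G N = trans (*-identityʳ _) 1#-homo
  nestedSum-ψ (s ▷ u) G N = begin
    ι (sign u ℚ.* σ) * nestedSum G N (u ◁ r)
      ≈⟨ *-cong (*-homo (sign u) σ) (nestedSum-◁ G N u r) ⟩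
    sgn u * ι σ * ∑[ i < N ] (G i u * Y i)
      ≈⟨ *-distribˡ-∑< N _ _ ⟩
    ∑[ i < N ] (sgn u * ι σ * (G i u * Y i))
      ≈⟨ ∑<-cong N (λ i → solve 4 (λ a b x y → a :* b :* (x :* y) := a :* x :* (b :* y)) refl _ _ _ _) ⟩
    ∑[ i < N ] (sgn u * G i u * (ι σ * Y i))
      ≈⟨ ∑<-cong-< N (λ i i<N → *-congˡ (trans (nestedSum-ψ s (shift (suc i) G) (N ∸ suc i))
           (nestedSum-cong-< (N ∸ suc i) s (λ j j<N∸i x → *-congˡ
             (reflexive (≡.cong (λ k → G k x) (m+[n∸m∸o]≡n∸o i<N j<N∸i))))))) ⟩
    ∑[ i < N ] (sgn u * G i u * nestedSum (mirror N G) (N ∸ suc i) s)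
      ≈⟨ ∑<-reverse N _ ⟩
    ∑[ j < N ] (sgn u * G (N ∸ suc j) u * nestedSum (mirror N G) (N ∸ suc (N ∸ suc j)) s)
      ≈⟨ ∑<-cong-< N (λ j j<N → trans (*-comm _ _)
           (*-congʳ (reflexive (≡.cong (λ k → nestedSum (mirror N G) k s) (n∸suc[n∸suc[m]]≡m j<N))))) ⟩
    ∑[ j < N ] (nestedSum (mirror N G) j s * mirror N G j u)  ∎
    where
    σ = proj₁ (psiW s)
    r = proj₂ (psiW s)
    Y : ℕ → Carrier
    Y i = nestedSum (shift (suc i) G) (N ∸ suc i) r

  sgn-+ : ∀ a b → sgn (a ℕ.+ b) ≈ sgn a * sgn b
  sgn-+ zero    b = sym (trans (*-congʳ 1#-homo) (*-identityˡ _))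
  sgn-+ (suc a) b = begin
    ι (ℚ.- sign (a ℕ.+ b))  ≈⟨ -‿homo _ ⟩
    - sgn (a ℕ.+ b)         ≈⟨ -‿cong (sgn-+ a b) ⟩
    - (sgn a * sgn b)       ≈⟨ -‿distribˡ-* _ _ ⟩
    - sgn a * sgn b         ≈⟨ *-congʳ (-‿homo _) ⟨
    sgn (suc a) * sgn b     ∎

  sgn-∘ : ∀ u v → sgn (∘-letter u v) ≈ sgn u * sgn v
  sgn-∘ zero    v       = sgn-+ zero v
  sgn-∘ (suc k) zero    = sym (trans (*-congˡ 1#-homo) (*-identityʳ _))
  sgn-∘ (suc k) (suc l) = sgn-+ (suc k) (suc l)

  mirror-isHarmonic : ∀ {G} N → IsHarmonic G → IsHarmonic (mirror N G)
  mirror-isHarmonic {G} N harm i u v = begin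
    p * (sgn (∘-letter u v) * G′ (∘-letter u v))
      ≈⟨ x∙yz≈y∙xz _ _ _ ⟩
    sgn (∘-letter u v) * (p * G′ (∘-letter u v))
      ≈⟨ *-cong (sgn-∘ u v) (harm (N ∸ suc i) u v) ⟩
    sgn u * sgn v * (G′ u * G′ v)
      ≈⟨ solve 4 (λ a b x y → a :* b :* (x :* y) := a :* x :* (b :* y)) refl _ _ _ _ ⟩
    sgn u * G′ u * (sgn v * G′ v)  ∎
    where
    p = pow ħ (∘-power u v)
    G′ = G (N ∸ suc i)

  ⟦⟧-linear₃ : ∀ k f g h X → ⟦ (λ w → f w + (g w + k * h w)) ⟧ X ≈ ⟦ f ⟧ X + (⟦ g ⟧ X + k * ⟦ h ⟧ X)
  ⟦⟧-linear₃ k f g h X = begin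
    ⟦ (λ w → f w + (g w + k * h w)) ⟧ X           ≈⟨ ⟦⟧-distrib-+ f _ X ⟩
    ⟦ f ⟧ X + ⟦ (λ w → g w + k * h w) ⟧ X          ≈⟨ +-congˡ (⟦⟧-distrib-+ g _ X) ⟩
    ⟦ f ⟧ X + (⟦ g ⟧ X + ⟦ (λ w → k * h w) ⟧ X)    ≈⟨ +-congˡ (+-congˡ (⟦⟧-*ˡ k h X)) ⟩
    ⟦ f ⟧ X + (⟦ g ⟧ X + k * ⟦ h ⟧ X)              ∎

  splitSum : (Word → Word → Carrier) → Word → Carrier
  splitSum T w = ∑ (λ { (p , s) → T p s }) (splits w)

  splitSum-cong : ∀ {T T′ : Word → Word → Carrier} → (∀ p s → T p s ≈ T′ p s) → ∀ w → splitSum T w ≈ splitSum T′ w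
  splitSum-cong T≈T′ w = ∑-cong (λ { (p , s) → T≈T′ p s }) (splits w)

  splitSum-linear₃ : ∀ k (T₁ T₂ T₃ : Word → Word → Carrier) w →
    splitSum (λ p s → T₁ p s + (T₂ p s + k * T₃ p s)) w ≈ splitSum T₁ w + (splitSum T₂ w + k * splitSum T₃ w)
  splitSum-linear₃ k T₁ T₂ T₃ w = ∑-linear₃ k _ _ _ (splits w)

  splitSum-distrib-+ : ∀ (T T′ : Word → Word → Carrier) w →
    splitSum (λ p s → T p s + T′ p s) w ≈ splitSum T w + splitSum T′ w
  splitSum-distrib-+ T T′ w = ∑-distrib-+ _ _ (splits w)

  *-distribʳ-splitSum : ∀ a (T : Word → Word → Carrier) w → splitSum T w * a ≈ splitSum (λ p s → T p s * a) w
  *-distribʳ-splitSum a T w = *-distribʳ-∑ a _ (splits w)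

  *-distribˡ-splitSum : ∀ a (T : Word → Word → Carrier) w → a * splitSum T w ≈ splitSum (λ p s → a * T p s) w
  *-distribˡ-splitSum a T w = *-distribˡ-∑ a _ (splits w)

  splitSum-ε : ∀ T → splitSum T ε ≈ T ε ε
  splitSum-ε T = +-identityʳ _

  _∣▷_ : (Word → Word → Carrier) → ℕ → Word → Word → Carrier
  (T ∣▷ u) p s = T p (s ▷ u)

  splitSum-▷ : ∀ T w u → splitSum T (w ▷ u) ≈ splitSum (T ∣▷ u) w + T (w ▷ u) ε
  splitSum-▷ T w u =
    trans (∑-++ _ (map _ (splits w)) ((w ▷ u , ε) ∷ []))
          (+-cong (reflexive (∑-map _ _ (splits w))) (+-identityʳ _))

  ⟦_⟧₂ : (Word → Word → Carrier) → Elem → Elem → Carrier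
  ⟦ T ⟧₂ P Q = ⟦ (λ x → ⟦ T x ⟧ Q) ⟧ P

  ⟦⟧₂-word : ∀ T P s → ⟦ T ⟧₂ P (word s) ≈ ⟦ (λ x → T x s) ⟧ P
  ⟦⟧₂-word T P s = ⟦⟧-cong (λ x → ⟦⟧-word (T x) s) P

  ⟦⟧₂-⊛ε : ∀ T P s → ⟦ T ⟧₂ P (s ⊛ ε) ≈ ⟦ (λ x → T x s) ⟧ P
  ⟦⟧₂-⊛ε T P s = ⟦⟧-cong (λ x → ⟦⟧-⊛ε (T x) s) P

  ⟦⟧₂-⊛-▷▷ : ∀ T P s u s' v →
    ⟦ T ⟧₂ P ((s ▷ u) ⊛ (s' ▷ v)) ≈
      ⟦ T ∣▷ u ⟧₂ P (s ⊛ (s' ▷ v)) + (⟦ T ∣▷ v ⟧₂ P ((s ▷ u) ⊛ s')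
        + pow ħ (∘-power u v) * ⟦ T ∣▷ ∘-letter u v ⟧₂ P (s ⊛ s'))
  ⟦⟧₂-⊛-▷▷ T P s u s' v = trans (⟦⟧-cong (λ x → ⟦⟧-⊛-▷▷ (T x) s u s' v) P) (⟦⟧-linear₃ _ _ _ _ P)

  -- ⟨ T , Δ w ∗ħ Δ w' ⟩ for the deconcatenation coproduct Δ
  splitProduct : (Word → Word → Carrier) → Word → Word → Carrier
  splitProduct T w w' = splitSum (λ p s → splitSum (λ p' s' → ⟦ T ⟧₂ (p ⊛ p') (s ⊛ s')) w') w

  ⟦splitSum⟧-⊛-▷▷ : ∀ T w u w' v →
    ⟦ splitSum T ⟧ ((w ▷ u) ⊛ (w' ▷ v)) ≈
      (⟦ splitSum (T ∣▷ u) ⟧ (w ⊛ (w' ▷ v)) + (⟦ splitSum (T ∣▷ v) ⟧ ((w ▷ u) ⊛ w')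
        + pow ħ (∘-power u v) * ⟦ splitSum (T ∣▷ ∘-letter u v) ⟧ (w ⊛ w')))
      + ⟦ (λ x → T x ε) ⟧ ((w ▷ u) ⊛ (w' ▷ v))
  ⟦splitSum⟧-⊛-▷▷ T w u w' v = begin
    ⟦ splitSum T ⟧ ((w ▷ u) ⊛ (w' ▷ v))
      ≈⟨ ⟦⟧-⊛-▷▷ (splitSum T) w u w' v ⟩
    ⟦ splitSum T ∘ (_▷ u) ⟧ X₁ + (⟦ splitSum T ∘ (_▷ v) ⟧ X₂ + p * ⟦ splitSum T ∘ (_▷ c′) ⟧ X₃)
      ≈⟨ +-cong (peel u X₁) (+-cong (peel v X₂) (*-congˡ (peel c′ X₃))) ⟩
    (⟦ splitSum (T ∣▷ u) ⟧ X₁ + ⟦ T₀ ∘ (_▷ u) ⟧ X₁)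
      + ((⟦ splitSum (T ∣▷ v) ⟧ X₂ + ⟦ T₀ ∘ (_▷ v) ⟧ X₂) + p * (⟦ splitSum (T ∣▷ c′) ⟧ X₃ + ⟦ T₀ ∘ (_▷ c′) ⟧ X₃))
      ≈⟨ solve 7 (λ a b g x y z p → (a :+ x) :+ ((b :+ y) :+ p :* (g :+ z))
                                   := (a :+ (b :+ p :* g)) :+ (x :+ (y :+ p :* z))) refl _ _ _ _ _ _ _ ⟩
    (⟦ splitSum (T ∣▷ u) ⟧ X₁ + (⟦ splitSum (T ∣▷ v) ⟧ X₂ + p * ⟦ splitSum (T ∣▷ c′) ⟧ X₃))
      + (⟦ T₀ ∘ (_▷ u) ⟧ X₁ + (⟦ T₀ ∘ (_▷ v) ⟧ X₂ + p * ⟦ T₀ ∘ (_▷ c′) ⟧ X₃))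
      ≈⟨ +-congˡ (⟦⟧-⊛-▷▷ T₀ w u w' v) ⟨
    (⟦ splitSum (T ∣▷ u) ⟧ X₁ + (⟦ splitSum (T ∣▷ v) ⟧ X₂ + p * ⟦ splitSum (T ∣▷ c′) ⟧ X₃))
      + ⟦ T₀ ⟧ ((w ▷ u) ⊛ (w' ▷ v))  ∎
    where
    X₁ = w ⊛ (w' ▷ v)
    X₂ = (w ▷ u) ⊛ w'
    X₃ = w ⊛ w'
    p  = pow ħ (∘-power u v)
    c′ = ∘-letter u v
    T₀ : Word → Carrier
    T₀ x = T x ε
    peel : ∀ a X → ⟦ splitSum T ∘ (_▷ a) ⟧ X ≈ ⟦ splitSum (T ∣▷ a) ⟧ X + ⟦ T₀ ∘ (_▷ a) ⟧ X
    peel a X = trans (⟦⟧-cong (λ x → splitSum-▷ T x a) X) (⟦⟧-distrib-+ _ _ X)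

  splitProduct-▷▷ : ∀ T w u w' v →
    splitProduct T (w ▷ u) (w' ▷ v) ≈
      (splitProduct (T ∣▷ u) w (w' ▷ v) + (splitProduct (T ∣▷ v) (w ▷ u) w'
        + pow ħ (∘-power u v) * splitProduct (T ∣▷ ∘-letter u v) w w'))
      + ⟦ (λ x → T x ε) ⟧ ((w ▷ u) ⊛ (w' ▷ v))
  splitProduct-▷▷ T w u w' v = begin
    splitProduct T W W'
      ≈⟨ splitSum-▷ H w u ⟩
    splitSum (λ p s → H p (s ▷ u)) w + H W ε
      ≈⟨ +-cong (splitSum-cong inner w) outer ⟩
    splitSum (λ p s → (splitSum (α p s) w' + (splitSum (β p s) w' + k * splitSum (γ p s) w')) + δ p s) w + (SZ + E₀)
      ≈⟨ +-congʳ (trans (splitSum-distrib-+ _ δ w) (+-congʳ (splitSum-linear₃ k _ _ _ w))) ⟩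
    ((SA + (SB + k * SG)) + SD) + (SZ + E₀)
      ≈⟨ solve 7 (λ a b g d z e k → ((a :+ (b :+ k :* g)) :+ d) :+ (z :+ e)
                                   := ((a :+ d) :+ ((b :+ z) :+ k :* g)) :+ e) refl SA SB SG SD SZ E₀ k ⟩
    ((SA + SD) + ((SB + SZ) + k * SG)) + E₀
      ≈⟨ +-congʳ (+-cong (sym splitU) (+-congʳ (sym (splitSum-▷ _ w u)))) ⟩
    (splitProduct (T ∣▷ u) w W' + (splitProduct (T ∣▷ v) W w' + k * splitProduct (T ∣▷ c′) w w')) + E₀  ∎
    where
    W  = w ▷ u
    W' = w' ▷ v
    k  = pow ħ (∘-power u v)
    c′ = ∘-letter u v
    H : Word → Word → Carrier
    H p s = splitSum (λ p' s' → ⟦ T ⟧₂ (p ⊛ p') (s ⊛ s')) W'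
    α β γ : Word → Word → Word → Word → Carrier
    α p s p' s' = ⟦ T ∣▷ u ⟧₂ (p ⊛ p') (s ⊛ (s' ▷ v))
    β p s p' s' = ⟦ T ∣▷ v ⟧₂ (p ⊛ p') ((s ▷ u) ⊛ s')
    γ p s p' s' = ⟦ T ∣▷ c′ ⟧₂ (p ⊛ p') (s ⊛ s')
    δ ζ : Word → Word → Carrier
    δ p s   = ⟦ T ∣▷ u ⟧₂ (p ⊛ W') (s ⊛ ε)
    ζ p' s' = ⟦ T ∣▷ v ⟧₂ (W ⊛ p') (ε ⊛ s')
    SA SB SG SD SZ E₀ : Carrier
    SA = splitSum (λ p s → splitSum (α p s) w') w
    SB = splitSum (λ p s → splitSum (β p s) w') w
    SG = splitSum (λ p s → splitSum (γ p s) w') w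
    SD = splitSum δ w
    SZ = splitSum ζ w'
    E₀ = ⟦ (λ x → T x ε) ⟧ (W ⊛ W')
    inner : ∀ p s → H p (s ▷ u) ≈ (splitSum (α p s) w' + (splitSum (β p s) w' + k * splitSum (γ p s) w')) + δ p s
    inner p s = trans (splitSum-▷ _ w' v)
      (+-cong (trans (splitSum-cong (λ p' s' → ⟦⟧₂-⊛-▷▷ T (p ⊛ p') s u s' v) w') (splitSum-linear₃ k _ _ _ w'))
              (trans (⟦⟧₂-⊛ε T (p ⊛ W') (s ▷ u)) (sym (⟦⟧₂-⊛ε (T ∣▷ u) (p ⊛ W') s))))
    outer : H W ε ≈ SZ + E₀
    outer = trans (splitSum-▷ _ w' v)
      (+-cong (splitSum-cong (λ p' s' → trans (⟦⟧₂-word T (W ⊛ p') (s' ▷ v)) (sym (⟦⟧₂-word (T ∣▷ v) (W ⊛ p') s'))) w')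
              (⟦⟧₂-word T (W ⊛ W') ε))
    splitU : splitProduct (T ∣▷ u) w W' ≈ SA + SD
    splitU = trans (splitSum-cong (λ p s → splitSum-▷ _ w' v) w) (splitSum-distrib-+ _ δ w)

  ⟦⟧₂-word-word : ∀ T p s → ⟦ T ⟧₂ (word p) (word s) ≈ T p s
  ⟦⟧₂-word-word T p s = trans (⟦⟧-word (λ x → ⟦ T x ⟧ (word s)) p) (⟦⟧-word (T p) s)

  ⟦splitSum⟧-⊛ : ∀ w w' T → ⟦ splitSum T ⟧ (w ⊛ w') ≈ splitProduct T w w'
  ⟦splitSum⟧-⊛ ε       w'       T = trans (⟦⟧-word (splitSum T) w')
    (sym (trans (splitSum-ε (λ p s → splitSum (λ p' s' → ⟦ T ⟧₂ (p ⊛ p') (s ⊛ s')) w')) (splitSum-cong (⟦⟧₂-word-word T) w')))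
  ⟦splitSum⟧-⊛ (w ▷ u) ε        T = trans (⟦⟧-word (splitSum T) (w ▷ u))
    (sym (splitSum-cong (λ p s → trans (splitSum-ε (λ p' s' → ⟦ T ⟧₂ (p ⊛ p') (s ⊛ s')))
      (trans (⟦⟧-⊛ε (λ x → ⟦ T x ⟧ (s ⊛ ε)) p) (⟦⟧-⊛ε (T p) s))) (w ▷ u)))
  ⟦splitSum⟧-⊛ (w ▷ u) (w' ▷ v) T =
    trans (⟦splitSum⟧-⊛-▷▷ T w u w' v)
      (trans (+-congʳ (+-cong (⟦splitSum⟧-⊛ w (w' ▷ v) (T ∣▷ u))
                        (+-cong (⟦splitSum⟧-⊛ (w ▷ u) w' (T ∣▷ v))
                                (*-congˡ (⟦splitSum⟧-⊛ w w' (T ∣▷ ∘-letter u v))))))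
             (sym (splitProduct-▷▷ T w u w' v)))

  _⋆_ : (Word → Carrier) → (Word → Carrier) → Word → Carrier
  f ⋆ g = splitSum (λ p s → f p * g s)

  ⟦⟧₂-⊗ : ∀ f g P Q → ⟦ (λ p s → f p * g s) ⟧₂ P Q ≈ ⟦ f ⟧ P * ⟦ g ⟧ Q
  ⟦⟧₂-⊗ f g P Q = trans (⟦⟧-cong (λ x → ⟦⟧-*ˡ (f x) g Q) P) (⟦⟧-*ʳ (⟦ g ⟧ Q) f P)

  ⋆-isCharacter : ∀ {f g} → IsCharacter f → IsCharacter g → IsCharacter (f ⋆ g)
  ⋆-isCharacter {f} {g} f-char g-char w w' = begin
    ⟦ f ⋆ g ⟧ (w ⊛ w')
      ≈⟨ ⟦splitSum⟧-⊛ w w' _ ⟩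
    splitProduct (λ p s → f p * g s) w w'
      ≈⟨ splitSum-cong (λ p s → splitSum-cong (λ p' s' → trans (⟦⟧₂-⊗ f g (p ⊛ p') (s ⊛ s'))
           (trans (*-cong (f-char p p') (g-char s s')) (*-interchange _ _ _ _))) w') w ⟩
    splitSum (λ p s → splitSum (λ p' s' → f p * g s * (f p' * g s')) w') w
      ≈⟨ splitSum-cong (λ p s → *-distribˡ-splitSum _ _ w') w ⟨
    splitSum (λ p s → f p * g s * (f ⋆ g) w') w
      ≈⟨ *-distribʳ-splitSum _ _ w ⟨
    (f ⋆ g) w * (f ⋆ g) w'  ∎

  ⟦nestedSum⟧-wSW : ∀ {G} → IsHarmonic G → ∀ N w →
    ⟦ nestedSum G N ⟧ (wSW w) ≈ (nestedSum G N ⋆ nestedSum (mirror N G) N) w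
  ⟦nestedSum⟧-wSW {G} harm N w =
    trans (∑-concatMap _ _ (splits w)) (∑-cong (λ { (p , s) → term p s }) (splits w))
    where
    term : ∀ p s → ⟦ nestedSum G N ⟧ (scale (proj₁ (psiW s)) 0 (p ⊛ proj₂ (psiW s)))
                   ≈ nestedSum G N p * nestedSum (mirror N G) N s
    term p s = trans (⟦⟧-scale _ _ 0 (p ⊛ proj₂ (psiW s)))
      (trans (*-cong (*-identityʳ _) (nestedSum-isCharacter harm N p (proj₂ (psiW s))))
        (trans (x∙yz≈y∙xz _ _ _) (*-congˡ (nestedSum-ψ s G N))))

  F-harmonic : ∀ m u v → pow ħ (∘-power u v) * F m (∘-letter u v) ≈ F m u * F m v
  F-harmonic m zero    v       = *-congʳ (*-identityʳ ħ)
  F-harmonic m (suc k) zero    = trans (*-congʳ (*-identityʳ ħ)) (*-comm _ _)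
  F-harmonic m (suc k) (suc l) = begin
    1# * (pow q ((suc k ℕ.+ suc l) ℕ.* m) * pow (inv m) (suc k ℕ.+ suc l))
      ≈⟨ *-identityˡ _ ⟩
    pow q ((suc k ℕ.+ suc l) ℕ.* m) * pow (inv m) (suc k ℕ.+ suc l)
      ≈⟨ *-cong (trans (reflexive (≡.cong (pow q) (ℕₚ.*-distribʳ-+ m (suc k) (suc l)))) (pow-+ q (suc k ℕ.* m) (suc l ℕ.* m)))
                (pow-+ (inv m) (suc k) (suc l)) ⟩
    pow q (suc k ℕ.* m) * pow q (suc l ℕ.* m) * (pow (inv m) (suc k) * pow (inv m) (suc l))
      ≈⟨ *-interchange _ _ _ _ ⟩
    F m (suc k) * F m (suc l)  ∎

  Fₛ : Weights
  Fₛ i = F (suc i)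

  Fₛ-isHarmonic : IsHarmonic Fₛ
  Fₛ-isHarmonic i = F-harmonic (suc i)

  sumTo-suc : ∀ N f → sumTo (suc N) f ≈ ∑[ i < N ] f (suc i)
  sumTo-suc zero    f = refl
  sumTo-suc (suc N) f = +-congʳ (sumTo-suc N f)

  ZW≈nestedSum : ∀ N w → ZW (suc N) w ≈ nestedSum Fₛ N w
  ZW≈nestedSum N ε       = refl
  ZW≈nestedSum N (w ▷ u) = trans (sumTo-suc N _) (∑<-cong N (λ i → *-congʳ (ZW≈nestedSum i w)))

  Z≈⟦ZW⟧ : ∀ M X → Z M X ≈ ⟦ ZW M ⟧ X
  Z≈⟦ZW⟧ M []                = refl
  Z≈⟦ZW⟧ M ((c , n , w) ∷ X) = +-congˡ (Z≈⟦ZW⟧ M X)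

  ⟦⟧-wS : ∀ f X → ⟦ f ⟧ (wS X) ≈ ⟦ (λ w → ⟦ f ⟧ (wSW w)) ⟧ X
  ⟦⟧-wS f X = trans (⟦⟧-concatMap f _ X) (∑-cong (λ { (c , n , w) → ⟦⟧-scale f c n (wSW w) }) X)

  ZS≈⟦⋆⟧ : ∀ N X → ZS (suc N) X ≈ ⟦ nestedSum Fₛ N ⋆ nestedSum (mirror N Fₛ) N ⟧ X
  ZS≈⟦⋆⟧ N X = begin
    Z (suc N) (wS X)                              ≈⟨ Z≈⟦ZW⟧ (suc N) (wS X) ⟩
    ⟦ ZW (suc N) ⟧ (wS X)                          ≈⟨ ⟦⟧-cong (ZW≈nestedSum N) (wS X) ⟩
    ⟦ nestedSum Fₛ N ⟧ (wS X)                      ≈⟨ ⟦⟧-wS (nestedSum Fₛ N) X ⟩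
    ⟦ (λ w → ⟦ nestedSum Fₛ N ⟧ (wSW w)) ⟧ X       ≈⟨ ⟦⟧-cong (⟦nestedSum⟧-wSW Fₛ-isHarmonic N) X ⟩
    ⟦ nestedSum Fₛ N ⋆ nestedSum (mirror N Fₛ) N ⟧ X  ∎

  ZS-∗ħ : ∀ N X X' → ZS (suc N) (X ∗ħ X') ≈ ZS (suc N) X * ZS (suc N) X'
  ZS-∗ħ N X X' = begin
    ZS (suc N) (X ∗ħ X')       ≈⟨ ZS≈⟦⋆⟧ N (X ∗ħ X') ⟩
    ⟦ Φ ⟧ (X ∗ħ X')            ≈⟨ ⟦⟧-∗ħ Φ-isCharacter X X' ⟩
    ⟦ Φ ⟧ X * ⟦ Φ ⟧ X'         ≈⟨ *-cong (ZS≈⟦⋆⟧ N X) (ZS≈⟦⋆⟧ N X') ⟨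
    ZS (suc N) X * ZS (suc N) X'  ∎
    where
    Φ = nestedSum Fₛ N ⋆ nestedSum (mirror N Fₛ) N
    Φ-isCharacter : IsCharacter Φ
    Φ-isCharacter = ⋆-isCharacter (nestedSum-isCharacter Fₛ-isHarmonic N)
                                  (nestedSum-isCharacter (mirror-isHarmonic N Fₛ-isHarmonic) N)

proposition4p1 : {c ℓ : Level} (K : CommutativeRing c ℓ)
    (ι : ℚ → CommutativeRing.Carrier K)
    → RingMorphisms.IsRingHomomorphism (CommutativeRing.rawRing +-*-commutativeRing) (CommutativeRing.rawRing K) ι
    → (q : CommutativeRing.Carrier K) (inv : ℕ → CommutativeRing.Carrier K)
    → (∀ m → 1 ≤ m → CommutativeRing._≈_ K (CommutativeRing._*_ K (Eval.qint K ι q inv m) (inv m)) (CommutativeRing.1# K))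
    → (M : ℕ) → 1 ≤ M → (w w' : Elem)
    → CommutativeRing._≈_ K (Eval.ZS K ι q inv M (w ∗ħ w')) (CommutativeRing._*_ K (Eval.ZS K ι q inv M w) (Eval.ZS K ι q inv M w'))
proposition4p1 K ι ι-hom q inv _ (suc N) _ = HarmonicAlgebra.ZS-∗ħ K ι ι-hom q inv N
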